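{- Let $n\ge m\ge 2$ and $r\ge 2$ be integers with $n\ge\frac{1}{r-1}(m+r)(m+2r-1)$. Then $\chi_{r=}^*(K_m\times K_n)=\chi_{r=}^*(K_{m(n)})$. Moreover, for every positive integer $k$, $K_m\times K_n$ is $r$-equitably $k$-colorable if and only if $K_{m(n)}$ is $r$-equitably $k$-colorable.
   Context: All graphs are finite, simple, undirected. For a positive integer $k$, a (proper) $k$-coloring of a graph $G$ is a map $f:V(G)\to\{1,\dots,k\}$ with $f(x)\ne f(y)$ whenever $xy\in E(G)$; its color classes are the sets $f^{ -1}(i)$, $i=1,\dots,k$. For a positive integer $r$, an $r$-equitable $k$-coloring is a $k$-coloring in which any two color classes differ in size by at most $r$; $G$ is $r$-equitably $k$-colorable if it has one. The $r$-equitable chromatic threshold $\chi_{r=}^*(G)$ is the smallest integer $k$ such that $G$ is $r$-equitably $k'$-colorable for every $k'\ge k$. The Kronecker product $G\times H$ has vertex set $V(G)\times V(H)$, with $(x,y)(x',y')$ an edge iff $xx'\in E(G)$ and $yy'\in E(H)$. $K_{m(n)}$ denotes the complete $m$-partite graph with $n$ vertices in each part. -}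

module Defs where

open import Data.Nat using (ℕ; suc; _+_; _*_; _≤_)
open import Data.Fin using (Fin; remQuot)
open import Data.Fin.Properties using (_≟_)
open import Data.List using (length; filter)
open import Data.Product using (Σ; _×_; _,_; proj₁; proj₂)
open import Relation.Nullary using (¬_)
open import Relation.Binary.PropositionalEquality using (_≡_; _≢_)
open import Data.List using () renaming (tabulate to tabulateL)

record Graph : Set₁ where
  field
    size  : ℕ
    Adj   : Fin size → Fin size → Set
    irrefl : ∀ x → ¬ Adj x x
    sym    : ∀ x y → Adj x y → Adj y x
open Graph public

K : ℕ → Graph
K m = record
  { size = m
  ; Adj = λ x y → x ≢ y
  ; irrefl = λ x ne → ne _≡_.refl
  ; sym = λ x y ne eq → ne (Relation.Binary.PropositionalEquality.sym eq) }
  where import Relation.Binary.PropositionalEquality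

-- Kronecker product G × H; vertex set Fin (|G| * |H|) identified with
-- Fin |G| × Fin |H| via the bijection remQuot.
_⊗_ : Graph → Graph → Graph
G ⊗ H = record
  { size = size G * size H
  ; Adj = λ x y → Adj G (proj₁ (split x)) (proj₁ (split y))
                × Adj H (proj₂ (split x)) (proj₂ (split y))
  ; irrefl = λ x p → irrefl G _ (proj₁ p)
  ; sym = λ x y p → sym G _ _ (proj₁ p) , sym H _ _ (proj₂ p) }
  where
  split : Fin (size G * size H) → Fin (size G) × Fin (size H)
  split = remQuot {size G} (size H)

-- Complete m-partite graph K_{m(n)}: vertex set Fin (m * n) ≅ Fin m × Fin n
-- (first component = part); two vertices adjacent iff in different parts.
Kmp : ℕ → ℕ → Graph
Kmp m n = record
  { size = m * n
  ; Adj = λ x y → proj₁ (remQuot {m} n x) ≢ proj₁ (remQuot {m} n y)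
  ; irrefl = λ x ne → ne _≡_.refl
  ; sym = λ x y ne eq → ne (Relation.Binary.PropositionalEquality.sym eq) }
  where import Relation.Binary.PropositionalEquality

IsColoring : (G : Graph) (k : ℕ) → (Fin (size G) → Fin k) → Set
IsColoring G k f = ∀ x y → Adj G x y → f x ≢ f y

classSize : ∀ {N k} → (Fin N → Fin k) → Fin k → ℕ
classSize {N} f i = length (filter (λ x → f x ≟ i) (tabulateL {n = N} (λ x → x)))

IsREquitable : ∀ {N k} → ℕ → (Fin N → Fin k) → Set
IsREquitable r f = ∀ i j → classSize f i ≤ classSize f j + r

REquitablyColorable : ℕ → Graph → ℕ → Set
REquitablyColorable r G k =
  Σ (Fin (size G) → Fin k) λ f → IsColoring G k f × IsREquitable r f

ThresholdProp : ℕ → Graph → ℕ → Set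
ThresholdProp r G t = ∀ k' → 1 ≤ k' → t ≤ k' → REquitablyColorable r G k'

IsEqChromThreshold : ℕ → Graph → ℕ → Set
IsEqChromThreshold r G t =
  1 ≤ t × ThresholdProp r G t × (∀ s → 1 ≤ s → ThresholdProp r G s → t ≤ s)

-- K_m × K_n is a spanning subgraph of K_{m(n)}, so colorings of K_{m(n)} are colorings of K_m × K_n.
-- Conversely, let f be an r-equitable k-coloring of K_m × K_n that is not proper on K_{m(n)}: two
-- vertices in different parts share a color. They must share their column, and then every vertex of
-- that color lies in this column, so the class has at most m vertices and mn ≤ k(m + r). With
-- K = ⌊k/m⌋ the hypothesis on n turns this into K ≥ 1 and n ≤ (r - 1)K(K + 1). Now color K_{m(n)}
-- directly: k mod m parts get K + 1 private colors, the others K, and each part spreads its n vertices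
-- evenly over its colors. Every class size lies between ⌊n/(K+1)⌋ and ⌈n/K⌉, and these differ by at
-- most r.
module Submission where

open import Defs hiding (sym)
open import Data.Nat using (ℕ; _≤_; _*_; _+_; _∸_)
open import Data.Product using (_×_)
open import Function.Bundles using (_⇔_)

open import Data.Empty using (⊥-elim)
open import Data.Fin using (Fin; zero; suc; _↑ˡ_; _↑ʳ_; splitAt; inject≤; combine; remQuot; quotient; remainder)
open import Data.Fin.Properties
  using (_≟_; suc-injective; ↑ˡ-injective; ↑ʳ-injective; inject≤-injective; splitAt-↑ˡ; splitAt-↑ʳ;
         splitAt⁻¹-↑ˡ; splitAt⁻¹-↑ʳ; remQuot-combine)
open import Data.List using (length; filter; tabulate; _∷_; [])
open import Data.Nat using (zero; suc; _<_; z≤n; s≤s; _≤?_; NonZero; >-nonZero; _/_; _%_)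
open import Data.Nat.DivMod using (m≡m%n+[m/n]*n; m%n<n; m%n≤n)
open import Data.Nat.Properties
  using (+-0-commutativeMonoid; ≤-refl; ≤-reflexive; ≤-trans; ≤-antisym; ≤-total; ≤-pred; <⇒≤; <-irrefl;
         <-≤-trans; ≤-<-trans; +-assoc; +-suc; +-identityʳ; *-identityʳ; *-zeroʳ; *-suc; m≤m+n; m≤n+m;
         n≤1+n; m+[n∸m]≡n; +-mono-≤; +-monoˡ-≤; +-monoʳ-≤; +-monoˡ-<; *-mono-≤; *-monoˡ-≤; *-monoʳ-≤;
         *-monoˡ-<; *-distribˡ-+; +-comm; +-cancelʳ-≤; +-cancelˡ-<; *-cancelˡ-≤; *-cancelˡ-<; module ≤-Reasoning)
open import Data.Nat.Tactic.RingSolver using (solve)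
open import Data.Product using (Σ; _,_; proj₁; proj₂; map₂; uncurry)
open import Data.Sum using (inj₁; inj₂; [_,_]′)
open import Function using (_∘_; id; case_of_; Injective; Equivalence; mk⇔)
open import Function.Construct.Symmetry using (⇔-sym)
open import Level using (Level)
open import Relation.Binary.PropositionalEquality
  using (_≡_; _≢_; refl; sym; trans; subst; subst₂; cong; cong₂; module ≡-Reasoning)
open import Relation.Nullary using (¬_; Dec; yes; no)
open import Relation.Nullary.Decidable using (decidable-stable)
open import Relation.Unary using (Pred; Decidable)

open import Algebra.Properties.CommutativeMonoid.Sum +-0-commutativeMonoid
  using (sum; sum-syntax; sum-cong-≗; sum-replicate-zero; ∑-comm)

private
  variable
    a p p′ : Level
    A B : Set a
    N : ℕ

indicator : Dec A → ℕ
indicator (yes _) = 1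
indicator (no _)  = 0

indicator≤1 : (A? : Dec A) → indicator A? ≤ 1
indicator≤1 (yes _) = ≤-refl
indicator≤1 (no _)  = z≤n

indicator-no : (A? : Dec A) → ¬ A → indicator A? ≡ 0
indicator-no (yes a) ¬a = ⊥-elim (¬a a)
indicator-no (no _)  _  = refl

indicator-mono : (A? : Dec A) (B? : Dec B) → (A → B) → indicator A? ≤ indicator B?
indicator-mono (yes a) (yes _) _   = ≤-refl
indicator-mono (yes a) (no ¬b) a⇒b = ⊥-elim (¬b (a⇒b a))
indicator-mono (no _)  _       _   = z≤n

indicator-cong : (A? : Dec A) (B? : Dec B) → A ⇔ B → indicator A? ≡ indicator B?
indicator-cong A? B? A⇔B =
  ≤-antisym (indicator-mono A? B? (Equivalence.to A⇔B)) (indicator-mono B? A? (Equivalence.from A⇔B))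

∑-mono-≤ : {f g : Fin N → ℕ} → (∀ x → f x ≤ g x) → sum f ≤ sum g
∑-mono-≤ {zero}  _   = z≤n
∑-mono-≤ {suc N} f≤g = +-mono-≤ (f≤g zero) (∑-mono-≤ (f≤g ∘ suc))

∑-const : ∀ N c → ∑[ _ < N ] c ≡ N * c
∑-const zero    c = refl
∑-const (suc N) c = cong (c +_) (∑-const N c)

∑-1 : ∀ N → ∑[ _ < N ] 1 ≡ N
∑-1 N = trans (∑-const N 1) (*-identityʳ N)

∑-split : ∀ m {n} (f : Fin (m + n) → ℕ) → sum f ≡ ∑[ i < m ] f (i ↑ˡ n) + ∑[ j < n ] f (m ↑ʳ j)
∑-split zero    f = refl
∑-split (suc m) f = trans (cong (f zero +_) (∑-split m (f ∘ suc))) (sym (+-assoc (f zero) _ _))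

∑-combine : ∀ m {n} (f : Fin (m * n) → ℕ) → sum f ≡ ∑[ i < m ] ∑[ j < n ] f (combine i j)
∑-combine zero        f = refl
∑-combine (suc m) {n} f =
  trans (∑-split n f) (cong (∑[ j < n ] f (j ↑ˡ (m * n)) +_) (∑-combine m (f ∘ (n ↑ʳ_))))

count : {P : Pred (Fin N) p} → Decidable P → ℕ
count {N} P? = ∑[ x < N ] indicator (P? x)

module _ {P : Pred (Fin N) p} {Q : Pred (Fin N) p′} (P? : Decidable P) (Q? : Decidable Q) where

  count-mono : (∀ x → P x → Q x) → count P? ≤ count Q?
  count-mono P⇒Q = ∑-mono-≤ (λ x → indicator-mono (P? x) (Q? x) (P⇒Q x))

  count-cong : (∀ x → P x ⇔ Q x) → count P? ≡ count Q?
  count-cong P⇔Q = sum-cong-≗ (λ x → indicator-cong (P? x) (Q? x) (P⇔Q x))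

module _ {P : Pred (Fin N) p} (P? : Decidable P) where

  count≤size : count P? ≤ N
  count≤size = ≤-trans (∑-mono-≤ (λ x → indicator≤1 (P? x))) (≤-reflexive (∑-1 N))

  count-none : (∀ x → ¬ P x) → count P? ≡ 0
  count-none ¬P = trans (sum-cong-≗ (λ x → indicator-no (P? x) (¬P x))) (sum-replicate-zero N)

count-unique : {P : Pred (Fin N) p} (P? : Decidable P) (x₀ : Fin N) →
  P x₀ → (∀ x → P x → x ≡ x₀) → count P? ≡ 1
count-unique P? zero Px₀ unique with P? zero
... | no ¬Px₀ = ⊥-elim (¬Px₀ Px₀)
... | yes _   = cong suc (count-none (P? ∘ suc) (λ x Psx → case unique (suc x) Psx of λ ()))
count-unique P? (suc x₀) Px₀ unique with P? zero
... | yes P0 = case unique zero P0 of λ ()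
... | no  _  = count-unique (P? ∘ suc) x₀ Px₀ (λ x Psx → suc-injective (unique (suc x) Psx))

count-≤1 : {P : Pred (Fin N) p} (P? : Decidable P) → (∀ x y → P x → P y → x ≡ y) → count P? ≤ 1
count-≤1 {zero}  P? unique = z≤n
count-≤1 {suc N} P? unique with P? zero
... | yes P0 = ≤-reflexive (cong suc (count-none (P? ∘ suc) (λ x Psx → case unique zero (suc x) P0 Psx of λ ())))
... | no  _  = count-≤1 (P? ∘ suc) (λ x y Psx Psy → suc-injective (unique (suc x) (suc y) Psx Psy))

count-remainder : ∀ m {n} (j : Fin n) → count (λ x → remainder {m} n x ≟ j) ≡ m
count-remainder m {n} j = begin
  count (λ x → remainder {m} n x ≟ j)
    ≡⟨ ∑-combine m _ ⟩
  ∑[ i < m ] ∑[ j′ < n ] indicator (remainder {m} n (combine i j′) ≟ j)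
    ≡⟨ sum-cong-≗ {m} (λ i → sum-cong-≗ {n} (λ j′ → cong (λ x → indicator (proj₂ x ≟ j)) (remQuot-combine i j′))) ⟩
  ∑[ i < m ] count (_≟ j)
    ≡⟨ sum-cong-≗ {m} (λ _ → count-unique (_≟ j) j refl (λ _ → id)) ⟩
  ∑[ i < m ] 1
    ≡⟨ ∑-1 m ⟩
  m ∎
  where open ≡-Reasoning

length-filter-tabulate : {P : Pred A p} (P? : Decidable P) (g : Fin N → A) →
  length (filter P? (tabulate g)) ≡ ∑[ x < N ] indicator (P? (g x))
length-filter-tabulate {N = zero}  P? g = refl
length-filter-tabulate {N = suc N} P? g with P? (g zero)
... | yes _ = cong suc (length-filter-tabulate P? (g ∘ suc))
... | no  _ = length-filter-tabulate P? (g ∘ suc)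

module _ {k : ℕ} where

  classSize≡count : (f : Fin N → Fin k) (c : Fin k) → classSize f c ≡ count (λ x → f x ≟ c)
  classSize≡count f c = length-filter-tabulate (λ x → f x ≟ c) id

  ∑-classSize : (f : Fin N → Fin k) → ∑[ c < k ] classSize f c ≡ N
  ∑-classSize {N} f = begin
    ∑[ c < k ] classSize f c                   ≡⟨ sum-cong-≗ {k} (classSize≡count f) ⟩
    ∑[ c < k ] ∑[ x < N ] indicator (f x ≟ c)  ≡⟨ ∑-comm (λ c x → indicator (f x ≟ c)) ⟩
    ∑[ x < N ] count (f x ≟_)                  ≡⟨ sum-cong-≗ {N} (λ x → count-unique (f x ≟_) (f x) refl (λ _ → sym)) ⟩
    ∑[ x < N ] 1                               ≡⟨ ∑-1 N ⟩
    N                                          ∎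
    where open ≡-Reasoning

  REquitable⇒size≤k*[s+r] : ∀ {r s} (f : Fin N → Fin k) → IsREquitable r f →
    ∀ c → classSize f c ≤ s → N ≤ k * (s + r)
  REquitable⇒size≤k*[s+r] {N} {r} {s} f equitable c small = begin
    N                           ≡⟨ ∑-classSize f ⟨
    ∑[ c′ < k ] classSize f c′  ≤⟨ ∑-mono-≤ (λ c′ → ≤-trans (equitable c′ c) (+-monoˡ-≤ r small)) ⟩
    ∑[ c′ < k ] (s + r)         ≡⟨ ∑-const k (s + r) ⟩
    k * (s + r)                 ∎
    where open ≤-Reasoning

module _ {k k′ : ℕ} {φ : Fin k → Fin k′} where

  classSize-∘-injective : Injective _≡_ _≡_ φ → (h : Fin N → Fin k) (c : Fin k) →
    classSize (φ ∘ h) (φ c) ≡ classSize h c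
  classSize-∘-injective φ-injective h c = begin
    classSize (φ ∘ h) (φ c)      ≡⟨ classSize≡count (φ ∘ h) (φ c) ⟩
    count (λ x → φ (h x) ≟ φ c)  ≡⟨ count-cong (λ x → φ (h x) ≟ φ c) (λ x → h x ≟ c) (λ _ → mk⇔ φ-injective (cong φ)) ⟩
    count (λ x → h x ≟ c)        ≡⟨ classSize≡count h c ⟨
    classSize h c                ∎
    where open ≡-Reasoning

  classSize-∘-outside : ∀ {c} → (∀ x → φ x ≢ c) → (h : Fin N → Fin k) → classSize (φ ∘ h) c ≡ 0
  classSize-∘-outside {c = c} φ≢c h = trans (classSize≡count (φ ∘ h) c) (count-none _ (λ x → φ≢c (h x)))

-- Spreading n points evenly over q colors

-- ⌊n/q⌋ ≤ S ≤ ⌈n/q⌉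
NearShare : ℕ → ℕ → ℕ → Set
NearShare q n S = q * S < n + q × n < suc S * q

BalancedMap : ℕ → ℕ → Set
BalancedMap q n = Σ (Fin n → Fin q) λ h → ∀ t → NearShare q n (classSize h t)

NearShare-+ : ∀ {q R Q E} → R < q → E ≤ 1 → E ≤ R → NearShare q (R + Q * q) (E + Q)
NearShare-+ {q} {R} {Q} {E} R<q E≤1 E≤R = upper , lower
  where
  open ≤-Reasoning
  qE<R+q : ∀ {E} → E ≤ 1 → E ≤ R → q * E < R + q
  qE<R+q {zero}  _         _   = subst (_< R + q) (sym (*-zeroʳ q)) (<-≤-trans (≤-<-trans z≤n R<q) (m≤n+m q R))
  qE<R+q {suc _} (s≤s z≤n) 1≤R = subst (_< R + q) (sym (*-identityʳ q)) (+-monoˡ-≤ q 1≤R)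
  upper : q * (E + Q) < R + Q * q + q
  upper = begin-strict
    q * (E + Q)    ≡⟨ solve (q ∷ E ∷ Q ∷ []) ⟩
    q * E + Q * q  <⟨ +-monoˡ-< (Q * q) (qE<R+q E≤1 E≤R) ⟩
    R + q + Q * q  ≡⟨ solve (R ∷ q ∷ Q ∷ []) ⟩
    R + Q * q + q  ∎
  lower : R + Q * q < suc (E + Q) * q
  lower = begin-strict
    R + Q * q            <⟨ +-monoˡ-< (Q * q) R<q ⟩
    q + Q * q            ≤⟨ m≤n+m (q + Q * q) (E * q) ⟩
    E * q + (q + Q * q)  ≡⟨ solve (E ∷ q ∷ Q ∷ []) ⟩
    suc (E + Q) * q      ∎

module _ {q : ℕ} (R Q : ℕ) (R<q : R < q) where

  spread : Fin (R + Q * q) → Fin q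
  spread = [ (λ z → inject≤ z (<⇒≤ R<q)) , remainder {Q} q ]′ ∘ splitAt R

  private
    spread-↑ˡ : ∀ z → spread (z ↑ˡ Q * q) ≡ inject≤ z (<⇒≤ R<q)
    spread-↑ˡ z rewrite splitAt-↑ˡ R z (Q * q) = refl

    spread-↑ʳ : ∀ w → spread (R ↑ʳ w) ≡ remainder {Q} q w
    spread-↑ʳ w rewrite splitAt-↑ʳ R (Q * q) w = refl

    hits : Fin q → ℕ
    hits t = count (λ z → inject≤ z (<⇒≤ R<q) ≟ t)

    classSize-spread : ∀ t → classSize spread t ≡ hits t + Q
    classSize-spread t = begin
      classSize spread t
        ≡⟨ classSize≡count spread t ⟩
      count (λ x → spread x ≟ t)
        ≡⟨ ∑-split R _ ⟩
      ∑[ z < R ] indicator (spread (z ↑ˡ Q * q) ≟ t) + ∑[ w < Q * q ] indicator (spread (R ↑ʳ w) ≟ t)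
        ≡⟨ cong₂ _+_ (sum-cong-≗ {R} (λ z → cong (λ u → indicator (u ≟ t)) (spread-↑ˡ z)))
                     (sum-cong-≗ {Q * q} (λ w → cong (λ u → indicator (u ≟ t)) (spread-↑ʳ w))) ⟩
      hits t + count (λ w → remainder {Q} q w ≟ t)
        ≡⟨ cong (hits t +_) (count-remainder Q t) ⟩
      hits t + Q ∎
      where open ≡-Reasoning

  spread-NearShare : ∀ t → NearShare q (R + Q * q) (classSize spread t)
  spread-NearShare t = subst (NearShare q (R + Q * q)) (sym (classSize-spread t))
    (NearShare-+ R<q (count-≤1 (λ z → inject≤ z (<⇒≤ R<q) ≟ t)
                               (λ x y x≡t y≡t → inject≤-injective _ _ x y (trans x≡t (sym y≡t))))
                     (count≤size (λ z → inject≤ z (<⇒≤ R<q) ≟ t)))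

balancedMap : ∀ q n .{{_ : NonZero q}} → BalancedMap q n
balancedMap q n = subst (BalancedMap q) (sym (m≡m%n+[m/n]*n n q))
  (spread (n % q) (n / q) (m%n<n n q) , spread-NearShare (n % q) (n / q) (m%n<n n q))

-- ⌊n/(K+1)⌋ ≤ S ≤ ⌈n/K⌉
Balanced : ℕ → ℕ → ℕ → Set
Balanced K n S = K * S < n + K × n < suc S * suc K

NearShare⇒Balanced : ∀ {K n S} → NearShare K n S → Balanced K n S
NearShare⇒Balanced {K} {S = S} (upper , lower) = upper , <-≤-trans lower (*-monoʳ-≤ (suc S) (n≤1+n K))

NearShare-suc⇒Balanced : ∀ {K n S} → 1 ≤ K → NearShare (suc K) n S → Balanced K n S
NearShare-suc⇒Balanced {K} {n} {zero}  1≤K (_ , lower) =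
  subst (_< n + K) (sym (*-zeroʳ K)) (<-≤-trans 1≤K (m≤n+m K n)) , lower
NearShare-suc⇒Balanced {K} {n} {suc S} _   (upper , lower) =
  ≤-trans (s≤s (m≤n+m (K * suc S) S)) (≤-pred (subst (suc K * suc S <_) (+-suc n K) upper)) , lower

Balanced⇒≤+r : ∀ {K n r S₁ S₂} → 1 ≤ K → n ≤ r * K * suc K →
  Balanced K n S₁ → Balanced K n S₂ → S₁ ≤ S₂ + suc r
Balanced⇒≤+r {K} {n} {r} {S₁} {S₂} 1≤K n≤rK[1+K] (upper₁ , _) (_ , lower₂) =
  ≤-pred (*-cancelˡ-< K S₁ (suc (S₂ + suc r)) (begin-strict
    K * S₁                <⟨ upper₁ ⟩
    n + K                 ≤⟨ +-monoˡ-≤ K n≤K[S₂+1+r] ⟩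
    K * (S₂ + suc r) + K  ≡⟨ solve (K ∷ S₂ ∷ r ∷ []) ⟩
    K * suc (S₂ + suc r)  ∎))
  where
  open ≤-Reasoning
  n≤K[S₂+1+r] : n ≤ K * (S₂ + suc r)
  n≤K[S₂+1+r] with ≤-total (r * K) S₂
  ... | inj₁ rK≤S₂ = begin
    n                      ≤⟨ n≤rK[1+K] ⟩
    r * K * suc K          ≡⟨ solve (r ∷ K ∷ []) ⟩
    K * (r * K) + r * K    ≤⟨ +-monoˡ-≤ (r * K) (*-monoʳ-≤ K rK≤S₂) ⟩
    K * S₂ + r * K         ≤⟨ m≤n+m (K * S₂ + r * K) K ⟩
    K + (K * S₂ + r * K)   ≡⟨ solve (K ∷ S₂ ∷ r ∷ []) ⟩
    K * (S₂ + suc r)       ∎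
  ... | inj₂ S₂≤rK = ≤-pred (begin-strict
    n                         <⟨ lower₂ ⟩
    suc S₂ * suc K            ≡⟨ solve (S₂ ∷ K ∷ []) ⟩
    suc (K + K * S₂ + S₂)     ≤⟨ s≤s (+-monoʳ-≤ (K + K * S₂) S₂≤rK) ⟩
    suc (K + K * S₂ + r * K)  ≡⟨ cong suc (solve (K ∷ S₂ ∷ r ∷ [])) ⟩
    suc (K * (S₂ + suc r))    ∎)

-- Colorings of K_{m(n)} built part by part

↑ˡ≢↑ʳ : ∀ {m n} (i : Fin m) (j : Fin n) → i ↑ˡ n ≢ m ↑ʳ j
↑ˡ≢↑ʳ {m} {n} i j eq with trans (sym (splitAt-↑ˡ m i n)) (trans (cong (splitAt m) eq) (splitAt-↑ʳ m n j))
... | ()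

module _ {m n k : ℕ} where

  DisjointPalettes : (Fin m → Fin n → Fin k) → Set
  DisjointPalettes G = ∀ {i i′} j j′ → G i j ≡ G i′ j′ → i ≡ i′

  fromParts : (Fin m → Fin n → Fin k) → Fin (m * n) → Fin k
  fromParts G = uncurry G ∘ remQuot n

  fromParts-isColoring : ∀ {G} → DisjointPalettes G → IsColoring (Kmp m n) k (fromParts G)
  fromParts-isColoring disjoint x y different-parts same-color = different-parts (disjoint _ _ same-color)

  classSize-fromParts : ∀ G c → classSize (fromParts G) c ≡ ∑[ i < m ] classSize (G i) c
  classSize-fromParts G c = begin
    classSize (fromParts G) c
      ≡⟨ classSize≡count (fromParts G) c ⟩
    count (λ x → fromParts G x ≟ c)
      ≡⟨ ∑-combine m _ ⟩
    ∑[ i < m ] ∑[ j < n ] indicator (fromParts G (combine i j) ≟ c)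
      ≡⟨ sum-cong-≗ {m} (λ i → sum-cong-≗ {n} (λ j → cong (λ x → indicator (uncurry G x ≟ c)) (remQuot-combine i j))) ⟩
    ∑[ i < m ] count (λ j → G i j ≟ c)
      ≡⟨ sum-cong-≗ {m} (λ i → classSize≡count (G i) c) ⟨
    ∑[ i < m ] classSize (G i) c ∎
    where open ≡-Reasoning

BalancedPartColoring : (K m n k : ℕ) → Set
BalancedPartColoring K m n k = Σ (Fin m → Fin n → Fin k) λ G →
  DisjointPalettes G × ∀ c → Balanced K n (∑[ i < m ] classSize (G i) c)

addPart : ∀ {K m n q k} (h : Fin n → Fin q) → (∀ t → Balanced K n (classSize h t)) →
  BalancedPartColoring K m n k → BalancedPartColoring K (suc m) n (q + k)
addPart {K} {m} {n} {q} {k} h h-balanced (G , disjoint , balanced) = G⁺ , disjoint⁺ , balanced⁺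
  where
  G⁺ : Fin (suc m) → Fin n → Fin (q + k)
  G⁺ zero    j = h j ↑ˡ k
  G⁺ (suc i) j = q ↑ʳ G i j

  disjoint⁺ : DisjointPalettes G⁺
  disjoint⁺ {zero}  {zero}   j j′ eq = refl
  disjoint⁺ {zero}  {suc i′} j j′ eq = ⊥-elim (↑ˡ≢↑ʳ (h j) (G i′ j′) eq)
  disjoint⁺ {suc i} {zero}   j j′ eq = ⊥-elim (↑ˡ≢↑ʳ (h j′) (G i j) (sym eq))
  disjoint⁺ {suc i} {suc i′} j j′ eq = cong suc (disjoint j j′ (↑ʳ-injective q _ _ eq))

  open ≡-Reasoning

  new-color : ∀ t → ∑[ i < suc m ] classSize (G⁺ i) (t ↑ˡ k) ≡ classSize h t
  new-color t = begin
    classSize (G⁺ zero) (t ↑ˡ k) + ∑[ i < m ] classSize (G⁺ (suc i)) (t ↑ˡ k)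
      ≡⟨ cong₂ _+_ (classSize-∘-injective (↑ˡ-injective k _ _) h t)
                   (sum-cong-≗ {m} (λ i → classSize-∘-outside (λ c → ↑ˡ≢↑ʳ t c ∘ sym) (G i))) ⟩
    classSize h t + ∑[ i < m ] 0   ≡⟨ cong (classSize h t +_) (sum-replicate-zero m) ⟩
    classSize h t + 0              ≡⟨ +-identityʳ _ ⟩
    classSize h t                  ∎

  old-color : ∀ c → ∑[ i < suc m ] classSize (G⁺ i) (q ↑ʳ c) ≡ ∑[ i < m ] classSize (G i) c
  old-color c = cong₂ _+_ (classSize-∘-outside (λ t → ↑ˡ≢↑ʳ t c) h)
                          (sum-cong-≗ {m} (λ i → classSize-∘-injective (↑ʳ-injective q _ _) (G i) c))

  balanced⁺ : ∀ c → Balanced K n (∑[ i < suc m ] classSize (G⁺ i) c)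
  balanced⁺ c with splitAt q c in eq
  ... | inj₁ t  = subst (λ c → Balanced K n (∑[ i < suc m ] classSize (G⁺ i) c)) (splitAt⁻¹-↑ˡ eq)
                    (subst (Balanced K n) (sym (new-color t)) (h-balanced t))
  ... | inj₂ c′ = subst (λ c → Balanced K n (∑[ i < suc m ] classSize (G⁺ i) c)) (splitAt⁻¹-↑ʳ eq)
                    (subst (Balanced K n) (sym (old-color c′)) (balanced c′))

module _ {K n : ℕ} (1≤K : 1 ≤ K) where

  private
    instance
      K-nonZero : NonZero K
      K-nonZero = >-nonZero 1≤K

    balancedK : Σ (Fin n → Fin K) λ h → ∀ t → Balanced K n (classSize h t)
    balancedK = map₂ (NearShare⇒Balanced ∘_) (balancedMap K n)

    balanced1+K : Σ (Fin n → Fin (suc K)) λ h → ∀ t → Balanced K n (classSize h t)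
    balanced1+K = map₂ (NearShare-suc⇒Balanced 1≤K ∘_) (balancedMap (suc K) n)

  balancedPartColoring : ∀ m e → e ≤ m → BalancedPartColoring K m n (e + K * m)
  balancedPartColoring zero zero z≤n =
    subst (BalancedPartColoring K 0 n) (sym (*-zeroʳ K)) ((λ ()) , (λ {i} → case i of λ ()) , λ ())
  balancedPartColoring (suc m) zero z≤n =
    subst (BalancedPartColoring K (suc m) n) (sym (*-suc K m))
      (uncurry addPart balancedK (balancedPartColoring m zero z≤n))
  balancedPartColoring (suc m) (suc e) (s≤s e≤m) =
    subst (BalancedPartColoring K (suc m) n) colors
      (uncurry addPart balanced1+K (balancedPartColoring m e e≤m))
    where
    colors : suc K + (e + K * m) ≡ suc e + K * suc m
    colors = solve (K ∷ e ∷ m ∷ [])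

  Kmp-REquitablyColorable : ∀ {m e r} → e ≤ m → n ≤ r * K * suc K →
    REquitablyColorable (suc r) (Kmp m n) (e + K * m)
  Kmp-REquitablyColorable {m} {e} {r} e≤m n≤rK[1+K]
    with G , disjoint , balanced ← balancedPartColoring m e e≤m =
    fromParts G , fromParts-isColoring disjoint , λ c c′ →
      subst₂ (λ a b → a ≤ b + suc r) (sym (classSize-fromParts G c)) (sym (classSize-fromParts G c′))
        (Balanced⇒≤+r 1≤K n≤rK[1+K] (balanced c) (balanced c′))

module _ {P r n : ℕ} (1≤P : 1 ≤ P) (1≤r : 1 ≤ r) (P[P+r]≤rn : P * (P + r) ≤ r * n) where

  open ≤-Reasoning

  private
    instance
      P-nonZero : NonZero P
      P-nonZero = >-nonZero 1≤P
      r-nonZero : NonZero r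
      r-nonZero = >-nonZero 1≤r

    P≤n : P ≤ n
    P≤n = *-cancelˡ-≤ r (begin
      r * P          ≤⟨ m≤n+m (r * P) (P * P) ⟩
      P * P + r * P  ≡⟨ solve (P ∷ r ∷ []) ⟩
      P * (P + r)    ≤⟨ P[P+r]≤rn ⟩
      r * n          ∎)

    d : ℕ
    d = n ∸ P

    n≡P+d : n ≡ P + d
    n≡P+d = sym (m+[n∸m]≡n P≤n)

    PP≤rd : P * P ≤ r * d
    PP≤rd = +-cancelʳ-≤ (r * P) (P * P) (r * d) (begin
      P * P + r * P  ≡⟨ solve (P ∷ r ∷ []) ⟩
      P * (P + r)    ≤⟨ P[P+r]≤rn ⟩
      r * n          ≡⟨ cong (r *_) n≡P+d ⟩
      r * (P + d)    ≡⟨ *-distribˡ-+ r P d ⟩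
      r * P + r * d  ≡⟨ +-comm (r * P) (r * d) ⟩
      r * d + r * P  ∎)

  n<[1+K]P⇒1≤K : ∀ {K} → n < suc K * P → 1 ≤ K
  n<[1+K]P⇒1≤K {zero}  n<P+0 = ⊥-elim (<-irrefl refl (<-≤-trans n<P+0 (subst (_≤ n) (sym (+-identityʳ P)) P≤n)))
  n<[1+K]P⇒1≤K {suc _} _     = s≤s z≤n

  n<[1+K]P⇒n≤rK[1+K] : ∀ {K} → n < suc K * P → n ≤ r * K * suc K
  n<[1+K]P⇒n≤rK[1+K] {K} n<[1+K]P = *-cancelˡ-≤ (P * P) {{>-nonZero (*-mono-≤ 1≤P 1≤P)}} (begin
    P * P * n                  ≤⟨ *-monoˡ-≤ n PP≤rd ⟩
    r * d * n                  ≤⟨ *-mono-≤ (*-monoʳ-≤ r d≤KP) (<⇒≤ n<[1+K]P) ⟩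
    r * (K * P) * (suc K * P)  ≡⟨ solve (r ∷ K ∷ P ∷ []) ⟩
    P * P * (r * K * suc K)    ∎)
    where
    d≤KP : d ≤ K * P
    d≤KP = <⇒≤ (+-cancelˡ-< P d (K * P) (subst (_< suc K * P) n≡P+d n<[1+K]P))

k<[1+k/m]*m : ∀ k m .{{_ : NonZero m}} → k < suc (k / m) * m
k<[1+k/m]*m k m = subst (_< suc (k / m) * m) (sym (m≡m%n+[m/n]*n k m)) (+-monoˡ-< (k / m * m) (m%n<n k m))

mn≤kP⇒n<[1+K]P : ∀ {m n k K P} .{{_ : NonZero P}} → k < suc K * m → m * n ≤ k * P → n < suc K * P
mn≤kP⇒n<[1+K]P {m} {n} {k} {K} {P} k<[1+K]m mn≤kP = *-cancelˡ-< m n (suc K * P) (begin-strict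
  m * n            ≤⟨ mn≤kP ⟩
  k * P            <⟨ *-monoˡ-< P k<[1+K]m ⟩
  suc K * m * P    ≡⟨ solve (K ∷ m ∷ P ∷ []) ⟩
  m * (suc K * P)  ∎)
  where open ≤-Reasoning

module _ {m n k} {f : Fin (m * n) → Fin k} (proper : IsColoring (K m ⊗ K n) k f) where

  private
    part : Fin (m * n) → Fin m
    part = quotient {m} n
    column : Fin (m * n) → Fin n
    column = remainder {m} n

  module _ {x y : Fin (m * n)} (different-parts : part x ≢ part y) (same-color : f x ≡ f y) where

    private
      same-column : column x ≡ column y
      same-column = decidable-stable (column x ≟ column y) λ columns≢ →
        proper x y (different-parts , columns≢) same-color

      colorClass⊆column : ∀ z → f z ≡ f x → column z ≡ column x
      colorClass⊆column z fz≡fx = decidable-stable (column z ≟ column x) λ cz≢cx →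
        case part z ≟ part x of λ where
          (yes pz≡px) → proper z y ((λ pz≡py → different-parts (trans (sym pz≡px) pz≡py)) ,
                                    (λ cz≡cy → cz≢cx (trans cz≡cy (sym same-column))))
                               (trans fz≡fx same-color)
          (no pz≢px)  → proper z x (pz≢px , cz≢cx) fz≡fx

    sharedColor-classSize≤m : classSize f (f x) ≤ m
    sharedColor-classSize≤m = begin
      classSize f (f x)                  ≡⟨ classSize≡count f (f x) ⟩
      count (λ z → f z ≟ f x)            ≤⟨ count-mono (λ z → f z ≟ f x) (λ z → column z ≟ column x) colorClass⊆column ⟩
      count (λ z → column z ≟ column x)  ≡⟨ count-remainder m (column x) ⟩
      m                                  ∎
      where open ≤-Reasoning

Kmp⇒⊗ : ∀ {m n r k} → REquitablyColorable r (Kmp m n) k → REquitablyColorable r (K m ⊗ K n) k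
Kmp⇒⊗ (f , proper , equitable) = f , (λ x y adjacent → proper x y (proj₁ adjacent)) , equitable

⊗⇒Kmp : ∀ {m n r k} → 1 ≤ m → 1 ≤ r → (m + suc r) * (m + suc r + r) ≤ r * n →
  REquitablyColorable (suc r) (K m ⊗ K n) k → REquitablyColorable (suc r) (Kmp m n) k
⊗⇒Kmp {m} {n} {r} {k} 1≤m 1≤r n-large (f , proper , equitable) with m * n ≤? k * (m + suc r)
... | no mn≰k[m+1+r] =
  f , (λ x y different-parts same-color → mn≰k[m+1+r]
         (REquitable⇒size≤k*[s+r] f equitable (f x) (sharedColor-classSize≤m proper different-parts same-color))) ,
  equitable
... | yes mn≤k[m+1+r] =
  subst (REquitablyColorable (suc r) (Kmp m n)) (sym (m≡m%n+[m/n]*n k m))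
    (Kmp-REquitablyColorable (n<[1+K]P⇒1≤K 1≤P 1≤r n-large {k / m} n<[1+k/m]P) (m%n≤n k m)
                             (n<[1+K]P⇒n≤rK[1+K] 1≤P 1≤r n-large {k / m} n<[1+k/m]P))
  where
  P : ℕ
  P = m + suc r
  1≤P : 1 ≤ P
  1≤P = ≤-trans 1≤m (m≤m+n m (suc r))
  instance
    m-nonZero : NonZero m
    m-nonZero = >-nonZero 1≤m
    P-nonZero : NonZero P
    P-nonZero = >-nonZero 1≤P
  n<[1+k/m]P : n < suc (k / m) * P
  n<[1+k/m]P = mn≤kP⇒n<[1+K]P {m} {n} {k} {k / m} (k<[1+k/m]*m k m) mn≤k[m+1+r]

threshold-transfer : ∀ {r} G H → (∀ k → 1 ≤ k → REquitablyColorable r G k ⇔ REquitablyColorable r H k) →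
  ∀ t → IsEqChromThreshold r G t → IsEqChromThreshold r H t
threshold-transfer G H G⇔H t (1≤t , threshold , least) =
  1≤t ,
  (λ k 1≤k t≤k → Equivalence.to (G⇔H k 1≤k) (threshold k 1≤k t≤k)) ,
  (λ s 1≤s H-threshold → least s 1≤s (λ k 1≤k s≤k → Equivalence.from (G⇔H k 1≤k) (H-threshold k 1≤k s≤k)))

threshold-cong : ∀ {r} G H → (∀ k → 1 ≤ k → REquitablyColorable r G k ⇔ REquitablyColorable r H k) →
  ∀ t → IsEqChromThreshold r G t ⇔ IsEqChromThreshold r H t
threshold-cong G H G⇔H t =
  mk⇔ (threshold-transfer G H G⇔H t) (threshold-transfer H G (λ k 1≤k → ⇔-sym (G⇔H k 1≤k)) t)

theorem7 : ∀ (m n r : ℕ) → 2 ≤ m → m ≤ n → 2 ≤ r →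
    (m + r) * (m + 2 * r ∸ 1) ≤ (r ∸ 1) * n →
    (∀ t → IsEqChromThreshold r (K m ⊗ K n) t ⇔ IsEqChromThreshold r (Kmp m n) t)
    × (∀ k → 1 ≤ k →
    REquitablyColorable r (K m ⊗ K n) k ⇔ REquitablyColorable r (Kmp m n) k)
theorem7 m n (suc r) 2≤m _ (s≤s 1≤r) n-large = threshold-cong (K m ⊗ K n) (Kmp m n) colorable⇔ , colorable⇔
  where
  m+2[1+r]≡1+[m+1+r+r] : m + 2 * suc r ≡ suc (m + suc r + r)
  m+2[1+r]≡1+[m+1+r+r] = solve (m ∷ r ∷ [])

  colorable⇔ : ∀ k → 1 ≤ k → REquitablyColorable (suc r) (K m ⊗ K n) k ⇔ REquitablyColorable (suc r) (Kmp m n) k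
  colorable⇔ k _ = mk⇔ (⊗⇒Kmp (≤-trans (s≤s z≤n) 2≤m) 1≤r
    (subst (λ a → (m + suc r) * (a ∸ 1) ≤ r * n) m+2[1+r]≡1+[m+1+r+r] n-large)) Kmp⇒⊗
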